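{- There is an absolute constant $C$ such that the following holds. Let $D=(V,A)$ be an AUSO of the graph of a simple $4$-polytope and let $v_{\mathrm{st}}\in V$ be an arbitrary starting vertex. Let $\Pi=\{V_1,\dots,V_\ell\}$ be a partition of $V$ such that the quotient digraph $D/\Pi$ is acyclic, and for each $i$ let $\lambda_i:V_i\to\mathbb{Z}$ be effectively decreasing with respect to $V_i$. Then the expected number of pivot steps of the random edge algorithm started at $v_{\mathrm{st}}$ until it reaches the global sink of $D$ is at most $C\sum_{i=1}^{\ell}|\lambda_i(V_i)|$.
   Context: An orientation $D$ of the graph (1-skeleton) of a polytope $P$ is an acyclic unique sink orientation (AUSO) if $D$ is acyclic and for every nonempty face $F$ of $P$ the subgraph induced by the vertices of $F$ has a unique sink; the global sink is the unique sink of $D$. The quotient digraph $D/\Pi$ is obtained from $D$ by identifying all vertices within each class of $\Pi$ and deleting loops and parallel arcs. For $W\subseteq V$, a function $\lambda:W\to\mathbb{Z}$ is effectively decreasing with respect to $W$ if $\lambda(v)\ge\lambda(w)$ for every arc $(v,w)\in A$ with $v,w\in W$, and every $v\in W$ that is not the global sink of $D$ has an outgoing arc $(v,w)\in A$ with $w\notin W$ or $\lambda(v)>\lambda(w)$. The random edge algorithm: at the current vertex, if it is not the global sink, move along an outgoing arc chosen uniformly at random among its outgoing arcs; a pivot step is one such move.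
   Formalization: The vertices of the simple 4-polytope have rational coordinates. -}

module Defs where

open import Data.Nat as ℕ using (ℕ; zero; suc)
open import Data.Integer as ℤ using (ℤ; +_)
open import Data.Rational as ℚ using (ℚ; 0ℚ; 1ℚ)
open import Data.Fin using (Fin; _≟_)
open import Data.List using (List; []; _∷_; map; filter; length; deduplicate; foldr)
open import Data.List.Base using (allFin)
open import Data.Bool using (Bool; true; false)
open import Data.Product using (Σ; ∃; ∃-syntax; _×_; _,_)
open import Data.Sum using (_⊎_)
import Data.Nat.ListAction
open import Relation.Nullary using (¬_)
open import Relation.Binary.PropositionalEquality using (_≡_; _≢_)

-- Geometry in ℚ⁴ (a polytope is given by its list of vertices)

Point : Set
Point = Fin 4 → ℚ

sumℚ : List ℚ → ℚ
sumℚ = foldr ℚ._+_ 0ℚ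

dot : Point → Point → ℚ
dot c x = sumℚ (map (λ k → c k ℚ.* x k) (allFin 4))

module _ {n : ℕ} (p : Fin n → Point) where

  AllVertices : Set
  AllVertices = ∀ i → ∃[ c ] (∀ j → j ≢ i → dot c (p j) ℚ.< dot c (p i))

  FullDim : Set
  FullDim = ∀ (c : Point) → (∀ i j → dot c (p i) ≡ dot c (p j)) → ∀ k → c k ≡ 0ℚ

  InFace : Point → Fin n → Set
  InFace c v = ∀ w → dot c (p w) ℚ.≤ dot c (p v)

  Edge : Fin n → Fin n → Set
  Edge u v = u ≢ v × ∃[ c ] (dot c (p u) ≡ dot c (p v)
                 × (∀ w → w ≢ u → w ≢ v → dot c (p w) ℚ.< dot c (p u)))

  Simple4 : Set
  Simple4 = ∀ i → Σ (Fin 4 → Fin n) λ f →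
              (∀ k l → f k ≡ f l → k ≡ l)
            × (∀ k → Edge i (f k))
            × (∀ j → Edge i j → ∃[ k ] f k ≡ j)

  SimplePolytope4 : Set
  SimplePolytope4 = AllVertices × FullDim × Simple4

data Path⁺ {m : ℕ} (R : Fin m → Fin m → Set) : Fin m → Fin m → Set where
  step : ∀ {u v} → R u v → Path⁺ R u v
  _∷ₚ_ : ∀ {u v w} → R u v → Path⁺ R v w → Path⁺ R u w

Acyclic : {m : ℕ} → (Fin m → Fin m → Set) → Set
Acyclic R = ∀ v → ¬ Path⁺ R v v

module _ {n : ℕ} (arc : Fin n → Fin n → Bool) where

  Arc : Fin n → Fin n → Set
  Arc u v = arc u v ≡ true

  Sink : Fin n → Set
  Sink v = ∀ w → arc v w ≡ false

  outs : Fin n → List (Fin n)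
  outs v = filter (λ w → arc v w Data.Bool.≟ true) (allFin n)

  -- expected number of random-edge pivot steps from v, computed with
  -- fuel k (exact once k ≥ longest path length, e.g. k = n, for acyclic D)
  expStepsF : ℕ → Fin n → ℚ
  expStepsF zero v = 0ℚ
  expStepsF (suc k) v with outs v
  ... | [] = 0ℚ
  ... | w ∷ ws = 1ℚ ℚ.+ (sumℚ (map (expStepsF k) (w ∷ ws)) ℚ.* (+ 1 ℚ./ suc (length ws)))

  expSteps : Fin n → ℚ
  expSteps = expStepsF n

module _ {n : ℕ} (p : Fin n → Point) (arc : Fin n → Fin n → Bool) where

  IsOrientation : Set
  IsOrientation = (∀ u v → Arc arc u v → Edge p u v)
                × (∀ u v → Edge p u v → Arc arc u v ⊎ Arc arc v u)
                × (∀ u v → Arc arc u v → ¬ Arc arc v u)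

  -- every nonempty face (= the maximisers of some functional c; c = 0 gives P)
  -- induces a subgraph with a unique sink
  UniqueSinkFaces : Set
  UniqueSinkFaces = ∀ (c : Point) →
    ∃[ v ] (InFace p c v × (∀ w → InFace p c w → arc v w ≡ false)
           × (∀ v′ → InFace p c v′ → (∀ w → InFace p c w → arc v′ w ≡ false) → v′ ≡ v))

  AUSO : Set
  AUSO = IsOrientation × Acyclic (Arc arc) × UniqueSinkFaces

module _ {n ℓ : ℕ} (cls : Fin n → Fin ℓ) where

  Partition : Set
  Partition = ∀ i → ∃[ v ] cls v ≡ i

  QuotArc : (Fin n → Fin n → Bool) → Fin ℓ → Fin ℓ → Set
  QuotArc arc i j = i ≢ j × ∃[ u ] ∃[ v ] (cls u ≡ i × cls v ≡ j × Arc arc u v)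

  EffDec : (Fin n → Fin n → Bool) → (Fin n → ℤ) → Fin ℓ → Set
  EffDec arc lam i =
      (∀ u v → cls u ≡ i → cls v ≡ i → Arc arc u v → lam v ℤ.≤ lam u)
    × (∀ v → cls v ≡ i → ¬ Sink arc v →
         ∃[ w ] (Arc arc v w × (cls w ≢ i ⊎ lam w ℤ.< lam v)))

  classOf : Fin ℓ → List (Fin n)
  classOf i = filter (λ v → cls v ≟ i) (allFin n)

  imageSize : (Fin n → ℤ) → Fin ℓ → ℕ
  imageSize lam i = length (deduplicate ℤ._≟_ (map lam (classOf i)))

  totalImage : (Fin n → ℤ) → ℕ
  totalImage lam = Data.Nat.ListAction.sum (map (imageSize lam) (allFin ℓ))

{-# OPTIONS --safe #-}
-- Let Φ(v) count the pairs (i, x) with x ∈ λ_i(V_i) such that some vertex of V_i with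
-- λ-value x is reachable from v, so Φ ≤ Σ_i |λ_i(V_i)|.  Every walk of D descends in the
-- lexicographic order given by the class (ordered by the acyclic D/Π) and then λ, hence Φ
-- does not increase along arcs, and along the arc witnessing effective decrease at v it
-- drops strictly: the pair (class of v, λ v) is no longer reachable.  At a vertex of
-- out-degree d ≤ 4 the random edge recursion therefore gives
-- E(v) ≤ 1 + (4/d)(d Φ(v) − 1) ≤ 4 Φ(v), so C = 4.
module Submission where

open import Defs
open import Data.Nat using (ℕ; _*_)
open import Data.Integer using (ℤ; +_)
open import Data.Rational using (ℚ; _≤_; _/_)
open import Data.Fin using (Fin)
open import Data.Bool using (Bool)
open import Data.Product using (∃-syntax)

import Data.Nat as ℕ
import Data.Nat.Properties as ℕₚ
import Data.Nat.Coprimality as Coprimality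
import Data.Integer as ℤ
import Data.Integer.Properties as ℤₚ
import Data.Rational as ℚ
import Data.Rational.Properties as ℚₚ
import Data.Fin as Fin
import Data.Bool as Bool
open import Data.Nat using (zero; suc; _+_; z≤n; s≤s)
open import Data.Nat.ListAction using (sum)
open import Data.Rational using (0ℚ; 1ℚ; mkℚ)
open import Data.List using (List; []; _∷_; map; filter; length; deduplicate; allFin)
open import Data.List.Properties using (length-removeAt′; length-filter)
open import Data.List.Membership.Propositional using (_∈_; _∉_; _─_)
open import Data.List.Membership.Propositional.Properties
  using (∈-filter⁺; ∈-filter⁻; ∈-allFin; ∈-map⁺; ∈-deduplicate⁺)
open import Data.List.Relation.Unary.Any as Any using (Any; here; there)
import Data.List.Relation.Unary.All as All
open import Data.List.Relation.Unary.AllPairs using (_∷_)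
open import Data.List.Relation.Unary.Unique.Propositional using (Unique)
import Data.List.Relation.Unary.Unique.Propositional.Properties as Unique
open import Data.List.Relation.Binary.Sublist.Propositional
  using (_∷_; _∷ʳ_; ⊆-refl) renaming (_⊆_ to _⊑_)
import Data.List.Relation.Binary.Sublist.Propositional.Properties as Sublist
open import Data.Product using (_×_; _,_; proj₁; proj₂)
open import Data.Sum using (_⊎_; inj₁; inj₂)
open import Function using (const)
open import Level using (0ℓ)
open import Relation.Nullary using (¬_; yes; no; contradiction)
open import Relation.Nullary.Decidable using (_×-dec_; _⊎-dec_)
open import Relation.Unary using (Pred; Decidable)
open import Relation.Binary.Construct.Closure.ReflexiveTransitive using (Star; ε; _◅_)
open import Relation.Binary.PropositionalEquality

fromℕ : ℕ → ℚ
fromℕ a = + a / 1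

fromℕ≡mkℚ : ∀ a → fromℕ a ≡ mkℚ (+ a) 0 (Coprimality.sym (Coprimality.1-coprimeTo a))
fromℕ≡mkℚ a = ℚₚ.normalize-coprime (Coprimality.sym (Coprimality.1-coprimeTo a))

fromℕ-homo-+ : ∀ a b → fromℕ (a + b) ≡ fromℕ a ℚ.+ fromℕ b
fromℕ-homo-+ a b
  rewrite fromℕ≡mkℚ a | fromℕ≡mkℚ b | ℤₚ.*-identityʳ (+ a) | ℤₚ.*-identityʳ (+ b)
        | sym (ℤₚ.pos-+ a b) = refl

fromℕ-homo-* : ∀ a b → fromℕ (a * b) ≡ fromℕ a ℚ.* fromℕ b
fromℕ-homo-* a b rewrite fromℕ≡mkℚ a | fromℕ≡mkℚ b | sym (ℤₚ.pos-* a b) = refl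

fromℕ-mono-≤ : ∀ {a b} → a ℕ.≤ b → fromℕ a ≤ fromℕ b
fromℕ-mono-≤ {a} {b} a≤b rewrite fromℕ≡mkℚ a | fromℕ≡mkℚ b =
  ℚ.*≤* (subst₂ ℤ._≤_ (sym (ℤₚ.*-identityʳ (+ a))) (sym (ℤₚ.*-identityʳ (+ b))) (ℤ.+≤+ a≤b))

fromℕ-nonNeg : ∀ a → 0ℚ ≤ fromℕ a
fromℕ-nonNeg a = fromℕ-mono-≤ {0} {a} z≤n

1/[1+m]*[1+m]≡1 : ∀ m → (+ 1 / suc m) ℚ.* fromℕ (suc m) ≡ 1ℚ
1/[1+m]*[1+m]≡1 m
  rewrite ℚₚ.normalize-coprime (Coprimality.1-coprimeTo (suc m)) | fromℕ≡mkℚ (suc m) =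
  ℚₚ.*-inverseˡ (mkℚ (+ suc m) 0 (Coprimality.sym (Coprimality.1-coprimeTo (suc m))))

-- Multiplying through by d = 1 + m turns the claim into d + S ≤ b d.
1+S/d≤fromℕ : ∀ (S : ℚ) a b m → S ≤ fromℕ a → suc m + a ℕ.≤ b * suc m →
              1ℚ ℚ.+ S ℚ.* (+ 1 / suc m) ≤ fromℕ b
1+S/d≤fromℕ S a b m S≤a d+a≤bd = ℚₚ.*-cancelʳ-≤-pos d {{d>0}} (begin
  (1ℚ ℚ.+ S ℚ.* d⁻¹) ℚ.* d        ≡⟨ ℚₚ.*-distribʳ-+ d 1ℚ (S ℚ.* d⁻¹) ⟩
  1ℚ ℚ.* d ℚ.+ S ℚ.* d⁻¹ ℚ.* d    ≡⟨ cong₂ ℚ._+_ (ℚₚ.*-identityˡ d) (ℚₚ.*-assoc S d⁻¹ d) ⟩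
  d ℚ.+ S ℚ.* (d⁻¹ ℚ.* d)         ≡⟨ cong (λ t → d ℚ.+ S ℚ.* t) (1/[1+m]*[1+m]≡1 m) ⟩
  d ℚ.+ S ℚ.* 1ℚ                  ≡⟨ cong (d ℚ.+_) (ℚₚ.*-identityʳ S) ⟩
  d ℚ.+ S                         ≤⟨ ℚₚ.+-monoʳ-≤ d S≤a ⟩
  d ℚ.+ fromℕ a                   ≡⟨ fromℕ-homo-+ (suc m) a ⟨
  fromℕ (suc m + a)               ≤⟨ fromℕ-mono-≤ d+a≤bd ⟩
  fromℕ (b * suc m)               ≡⟨ fromℕ-homo-* b (suc m) ⟩
  fromℕ b ℚ.* d                   ∎)
  where
  open ℚₚ.≤-Reasoning
  d = fromℕ (suc m)
  d⁻¹ = + 1 / suc m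
  d>0 : ℚ.Positive d
  d>0 = subst ℚ.Positive (sym (fromℕ≡mkℚ (suc m))) _

d+Δ*s≤Δ*N*d : ∀ {d Δ s N} → d ℕ.≤ Δ → suc s ℕ.≤ d * N → d + Δ * s ℕ.≤ Δ * N * d
d+Δ*s≤Δ*N*d {d} {Δ} {s} {N} d≤Δ 1+s≤dN = begin
  d + Δ * s     ≤⟨ ℕₚ.+-monoˡ-≤ (Δ * s) d≤Δ ⟩
  Δ + Δ * s     ≡⟨ ℕₚ.*-suc Δ s ⟨
  Δ * suc s     ≤⟨ ℕₚ.*-monoʳ-≤ Δ 1+s≤dN ⟩
  Δ * (d * N)   ≡⟨ cong (Δ *_) (ℕₚ.*-comm d N) ⟩
  Δ * (N * d)   ≡⟨ ℕₚ.*-assoc Δ N d ⟨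
  Δ * N * d     ∎
  where open ℕₚ.≤-Reasoning

module _ {A : Set} where

  sum-mono-≤ : ∀ {f g : A → ℕ} xs → (∀ {x} → x ∈ xs → f x ℕ.≤ g x) →
               sum (map f xs) ℕ.≤ sum (map g xs)
  sum-mono-≤ []       f≤g = z≤n
  sum-mono-≤ (x ∷ xs) f≤g = ℕₚ.+-mono-≤ (f≤g (here refl)) (sum-mono-≤ xs (λ x∈ → f≤g (there x∈)))

  sum-mono-< : ∀ {f g : A → ℕ} {y} xs → (∀ {x} → x ∈ xs → f x ℕ.≤ g x) →
               y ∈ xs → f y ℕ.< g y → sum (map f xs) ℕ.< sum (map g xs)
  sum-mono-< (x ∷ xs) f≤g (here refl) fy<gy =
    ℕₚ.+-mono-<-≤ fy<gy (sum-mono-≤ xs (λ x∈ → f≤g (there x∈)))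
  sum-mono-< (x ∷ xs) f≤g (there y∈) fy<gy =
    ℕₚ.+-mono-≤-< (f≤g (here refl)) (sum-mono-< xs (λ x∈ → f≤g (there x∈)) y∈ fy<gy)

  sum-map-const : ∀ c (xs : List A) → sum (map (const c) xs) ≡ length xs * c
  sum-map-const c []       = refl
  sum-map-const c (x ∷ xs) = cong (ℕ._+_ c) (sum-map-const c xs)

  sum-map-*ˡ : ∀ c (f : A → ℕ) xs → sum (map (λ x → c * f x) xs) ≡ c * sum (map f xs)
  sum-map-*ˡ c f []       = sym (ℕₚ.*-zeroʳ c)
  sum-map-*ˡ c f (x ∷ xs) =
    trans (cong (ℕ._+_ (c * f x)) (sum-map-*ˡ c f xs)) (sym (ℕₚ.*-distribˡ-+ c (f x) _))

  sumℚ-≤-fromℕ-sum : ∀ (E : A → ℚ) (f : A → ℕ) xs → (∀ {x} → x ∈ xs → E x ≤ fromℕ (f x)) →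
                     sumℚ (map E xs) ≤ fromℕ (sum (map f xs))
  sumℚ-≤-fromℕ-sum E f []       E≤f = ℚₚ.≤-refl
  sumℚ-≤-fromℕ-sum E f (x ∷ xs) E≤f = begin
    E x ℚ.+ sumℚ (map E xs)                 ≤⟨ ℚₚ.+-mono-≤ (E≤f (here refl))
                                                 (sumℚ-≤-fromℕ-sum E f xs (λ x∈ → E≤f (there x∈))) ⟩
    fromℕ (f x) ℚ.+ fromℕ (sum (map f xs))  ≡⟨ fromℕ-homo-+ (f x) _ ⟨
    fromℕ (f x + sum (map f xs))            ∎
    where open ℚₚ.≤-Reasoning

  ∈-─⁺ : ∀ {x z : A} {ys} (x∈ys : x ∈ ys) → z ∈ ys → z ≢ x → z ∈ ys ─ x∈ys
  ∈-─⁺ (here refl)  (here refl)  z≢x = contradiction refl z≢x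
  ∈-─⁺ (here refl)  (there z∈ys) _   = z∈ys
  ∈-─⁺ (there x∈ys) (here refl)  _   = here refl
  ∈-─⁺ (there x∈ys) (there z∈ys) z≢x = there (∈-─⁺ x∈ys z∈ys z≢x)

  Unique-⊆⇒length-≤ : ∀ {xs ys : List A} → Unique xs → (∀ {z} → z ∈ xs → z ∈ ys) →
                      length xs ℕ.≤ length ys
  Unique-⊆⇒length-≤ {[]}          _            _     = z≤n
  Unique-⊆⇒length-≤ {x ∷ xs} {ys} (x∉xs ∷ xs!) xs⊆ys =
    subst (suc (length xs) ℕ.≤_) (sym (length-removeAt′ ys (Any.index x∈ys)))
      (s≤s (Unique-⊆⇒length-≤ xs! λ z∈xs →
        ∈-─⁺ x∈ys (xs⊆ys (there z∈xs)) (λ z≡x → All.lookup x∉xs z∈xs (sym z≡x))))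
    where x∈ys = xs⊆ys (here refl)

  length-mono-< : ∀ {xs ys : List A} {y} → xs ⊑ ys → y ∈ ys → y ∉ xs → length xs ℕ.< length ys
  length-mono-< (_ ∷ʳ xs⊑ys)   (here refl) _    = s≤s (Sublist.length-mono-≤ xs⊑ys)
  length-mono-< (_ ∷ʳ xs⊑ys)   (there y∈)  y∉xs = ℕₚ.m≤n⇒m≤1+n (length-mono-< xs⊑ys y∈ y∉xs)
  length-mono-< (refl ∷ xs⊑ys) (here refl) y∉xs = contradiction (here refl) y∉xs
  length-mono-< (refl ∷ xs⊑ys) (there y∈)  y∉xs =
    s≤s (length-mono-< xs⊑ys y∈ (λ y∈xs → y∉xs (there y∈xs)))

  module _ {P Q : Pred A 0ℓ} (P? : Decidable P) (Q? : Decidable Q) (P⇒Q : ∀ {x} → P x → Q x) where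

    filter-⊑ : ∀ xs → filter P? xs ⊑ filter Q? xs
    filter-⊑ xs = Sublist.filter⁺ P? Q? (λ { refl Px → P⇒Q Px }) (⊆-refl {x = xs})

    length-filter-mono-≤ : ∀ xs → length (filter P? xs) ℕ.≤ length (filter Q? xs)
    length-filter-mono-≤ xs = Sublist.length-mono-≤ (filter-⊑ xs)

    length-filter-mono-< : ∀ {y} xs → y ∈ xs → Q y → ¬ P y →
                           length (filter P? xs) ℕ.< length (filter Q? xs)
    length-filter-mono-< xs y∈xs Qy ¬Py =
      length-mono-< (filter-⊑ xs) (∈-filter⁺ Q? y∈xs Qy)
        (λ y∈ → ¬Py (proj₂ (∈-filter⁻ P? {xs = xs} y∈)))

module _ {n : ℕ} (arc : Fin n → Fin n → Bool) where

  ∈-outs⁻ : ∀ {v w} → w ∈ outs arc v → Arc arc v w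
  ∈-outs⁻ {v} w∈ = proj₂ (∈-filter⁻ (λ w → arc v w Bool.≟ Bool.true) {xs = allFin n} w∈)

  ∈-outs⁺ : ∀ {v w} → Arc arc v w → w ∈ outs arc v
  ∈-outs⁺ {v} {w} = ∈-filter⁺ (λ w → arc v w Bool.≟ Bool.true) (∈-allFin w)

  Unique-outs : ∀ v → Unique (outs arc v)
  Unique-outs v = Unique.filter⁺ (λ w → arc v w Bool.≟ Bool.true) (Unique.allFin⁺ n)

  arc⇒¬Sink : ∀ {v w} → Arc arc v w → ¬ Sink arc v
  arc⇒¬Sink {w = w} v→w sink with trans (sym v→w) (sink w)
  ... | ()

  ReachesWithin : ℕ → Pred (Fin n) 0ℓ → Pred (Fin n) 0ℓ
  ReachesWithin zero    P v = P v
  ReachesWithin (suc k) P v = P v ⊎ Any (λ w → Arc arc v w × ReachesWithin k P w) (allFin n)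

  reachesWithin? : ∀ {P} → Decidable P → ∀ k → Decidable (ReachesWithin k P)
  reachesWithin? P? zero    v = P? v
  reachesWithin? P? (suc k) v =
    P? v ⊎-dec Any.any? (λ w → (arc v w Bool.≟ Bool.true) ×-dec reachesWithin? P? k w) (allFin n)

  reachesWithin-step : ∀ k {P v w} → Arc arc v w → ReachesWithin k P w → ReachesWithin (suc k) P v
  reachesWithin-step k {w = w} v→w reach =
    inj₂ (Any.map (λ { refl → v→w , reach }) (∈-allFin w))

  reachesWithin⇒walk : ∀ k {P v} → ReachesWithin k P v → ∃[ u ] (P u × Star (Arc arc) v u)
  reachesWithin⇒walk zero    Pv        = _ , Pv , ε
  reachesWithin⇒walk (suc k) (inj₁ Pv) = _ , Pv , ε
  reachesWithin⇒walk (suc k) (inj₂ any) with Any.satisfied any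
  ... | w , v→w , reach with reachesWithin⇒walk k reach
  ...   | u , Pu , walk = u , Pu , v→w ◅ walk

outdegree≤4 : ∀ {n} {p : Fin n → Point} {arc} → Simple4 p → IsOrientation p arc →
              ∀ v → length (outs arc v) ℕ.≤ 4
outdegree≤4 {arc = arc} simple (arc⇒edge , _) v with simple v
... | f , _ , _ , edge⇒image =
  Unique-⊆⇒length-≤ (Unique-outs arc v) λ {w} w∈ →
    let k , fk≡w = edge⇒image w (arc⇒edge v w (∈-outs⁻ arc w∈))
    in subst (_∈ map f (allFin 4)) fk≡w (∈-map⁺ f (∈-allFin k))

-- expStepsF is computed with fuel k, so the potential is indexed by the fuel as well.
module RandomEdge {n : ℕ} (arc : Fin n → Fin n → Bool) (Δ : ℕ)
  (outdegree≤Δ : ∀ v → length (outs arc v) ℕ.≤ Δ)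
  (Φ : ℕ → Fin n → ℕ)
  (Φ-antitone : ∀ k {v w} → Arc arc v w → Φ k w ℕ.≤ Φ (suc k) v)
  (Φ-drops : ∀ k v → ¬ Sink arc v → ∃[ w ] (Arc arc v w × Φ k w ℕ.< Φ (suc k) v)) where

  expStepsF≤Δ*Φ : ∀ k v → expStepsF arc k v ≤ fromℕ (Δ * Φ k v)
  expStepsF≤Δ*Φ zero    v = fromℕ-nonNeg (Δ * Φ _ v)
  expStepsF≤Δ*Φ (suc k) v with outs arc v in outs≡
  ... | []     = fromℕ-nonNeg (Δ * Φ _ v)
  ... | w ∷ ws = 1+S/d≤fromℕ _ (Δ * s) (Δ * N) (length ws) S≤Δs (d+Δ*s≤Δ*N*d d≤Δ 1+s≤dN)
    where
    xs = w ∷ ws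
    N  = Φ (suc k) v
    s  = sum (map (Φ k) xs)

    out : ∀ {u} → u ∈ xs → Arc arc v u
    out u∈ = ∈-outs⁻ arc (subst (_ ∈_) (sym outs≡) u∈)

    S≤Δs : sumℚ (map (expStepsF arc k) xs) ≤ fromℕ (Δ * s)
    S≤Δs = subst (λ t → sumℚ (map (expStepsF arc k) xs) ≤ fromℕ t) (sum-map-*ˡ Δ (Φ k) xs)
      (sumℚ-≤-fromℕ-sum (expStepsF arc k) (λ u → Δ * Φ k u) xs (λ {u} _ → expStepsF≤Δ*Φ k u))

    d≤Δ : length xs ℕ.≤ Δ
    d≤Δ = subst (ℕ._≤ Δ) (cong length outs≡) (outdegree≤Δ v)

    1+s≤dN : suc s ℕ.≤ length xs * N
    1+s≤dN with Φ-drops k v (arc⇒¬Sink arc (out (here refl)))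
    ... | w₀ , v→w₀ , drop = subst (suc s ℕ.≤_) (sum-map-const N xs)
      (sum-mono-< xs (λ u∈ → Φ-antitone k (out u∈)) (subst (_ ∈_) outs≡ (∈-outs⁺ arc v→w₀)) drop)

module Potential {n ℓ : ℕ} (arc : Fin n → Fin n → Bool) (cls : Fin n → Fin ℓ) (lam : Fin n → ℤ)
  (quotient-acyclic : Acyclic (QuotArc cls arc)) (effDec : ∀ i → EffDec cls arc lam i) where

  Labelled : Fin ℓ → ℤ → Pred (Fin n) 0ℓ
  Labelled i x u = cls u ≡ i × lam u ≡ x

  labelled? : ∀ i x → Decidable (Labelled i x)
  labelled? i x u = (cls u Fin.≟ i) ×-dec (lam u ℤ.≟ x)

  -- (i, x) lies weakly below (cls w, lam w): reachability in D/Π first, then λ.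
  Above : Fin n → Fin ℓ → ℤ → Set
  Above w i x = (cls w ≡ i × x ℤ.≤ lam w) ⊎ Path⁺ (QuotArc cls arc) (cls w) i

  quotArc : ∀ {v w} → cls v ≢ cls w → Arc arc v w → QuotArc cls arc (cls v) (cls w)
  quotArc v≁w v→w = v≁w , _ , _ , refl , refl , v→w

  arc-Above : ∀ {v w i x} → Arc arc v w → Above w i x → Above v i x
  arc-Above {v} {w} {i} v→w w≥ with cls v Fin.≟ cls w | w≥
  ... | yes v∼w | inj₁ (refl , x≤w) =
    inj₁ (v∼w , ℤₚ.≤-trans x≤w (proj₁ (effDec (cls v)) v w refl (sym v∼w) v→w))
  ... | yes v∼w | inj₂ path         =
    inj₂ (subst (λ c → Path⁺ (QuotArc cls arc) c i) (sym v∼w) path)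
  ... | no v≁w  | inj₁ (refl , _)   = inj₂ (step (quotArc v≁w v→w))
  ... | no v≁w  | inj₂ path         = inj₂ (quotArc v≁w v→w ∷ₚ path)

  walk-Above : ∀ {v u} → Star (Arc arc) v u → Above v (cls u) (lam u)
  walk-Above ε            = inj₁ (refl , ℤₚ.≤-refl)
  walk-Above (v→w ◅ walk) = arc-Above v→w (walk-Above walk)

  reachesWithin-Above : ∀ k {i x v} → ReachesWithin arc k (Labelled i x) v → Above v i x
  reachesWithin-Above k reach with reachesWithin⇒walk arc k reach
  ... | _ , (refl , refl) , walk = walk-Above walk

  effective-arc-¬Above : ∀ {v w} → Arc arc v w → (cls w ≢ cls v ⊎ lam w ℤ.< lam v) →
                         ¬ Above w (cls v) (lam v)
  effective-arc-¬Above v→w (inj₁ w≁v) (inj₁ (w∼v , _))   = w≁v w∼v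
  effective-arc-¬Above v→w (inj₂ w<v) (inj₁ (_ , v≤w))   = ℤₚ.<⇒≱ w<v v≤w
  effective-arc-¬Above {v} {w} v→w _ (inj₂ path) with cls v Fin.≟ cls w
  ... | yes v∼w =
    quotient-acyclic (cls v) (subst (λ c → Path⁺ (QuotArc cls arc) c (cls v)) (sym v∼w) path)
  ... | no v≁w  = quotient-acyclic (cls v) (quotArc v≁w v→w ∷ₚ path)

  values : Fin ℓ → List ℤ
  values i = deduplicate ℤ._≟_ (map lam (classOf cls i))

  lam∈values : ∀ v → lam v ∈ values (cls v)
  lam∈values v =
    ∈-deduplicate⁺ ℤ._≟_ (∈-map⁺ lam (∈-filter⁺ (λ u → cls u Fin.≟ cls v) (∈-allFin v) refl))

  reachableValues : ℕ → Fin n → Fin ℓ → ℕ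
  reachableValues k v i =
    length (filter (λ x → reachesWithin? arc (labelled? i x) k v) (values i))

  Φ : ℕ → Fin n → ℕ
  Φ k v = sum (map (reachableValues k v) (allFin ℓ))

  reachableValues-antitone : ∀ k {v w} → Arc arc v w → ∀ i →
                             reachableValues k w i ℕ.≤ reachableValues (suc k) v i
  reachableValues-antitone k v→w i =
    length-filter-mono-≤ _ _ (reachesWithin-step arc k v→w) (values i)

  Φ-antitone : ∀ k {v w} → Arc arc v w → Φ k w ℕ.≤ Φ (suc k) v
  Φ-antitone k v→w = sum-mono-≤ (allFin ℓ) (λ {i} _ → reachableValues-antitone k v→w i)

  reachableValues-drops : ∀ k {v w} → Arc arc v w → (cls w ≢ cls v ⊎ lam w ℤ.< lam v) →
                          reachableValues k w (cls v) ℕ.< reachableValues (suc k) v (cls v)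
  reachableValues-drops k {v} v→w effective =
    length-filter-mono-< _ _ (reachesWithin-step arc k v→w) (values (cls v)) (lam∈values v)
      (inj₁ (refl , refl))
      (λ reach → effective-arc-¬Above v→w effective (reachesWithin-Above k reach))

  Φ-drops : ∀ k v → ¬ Sink arc v → ∃[ w ] (Arc arc v w × Φ k w ℕ.< Φ (suc k) v)
  Φ-drops k v ¬sink with proj₂ (effDec (cls v)) v refl ¬sink
  ... | w , v→w , effective = w , v→w ,
    sum-mono-< (allFin ℓ) (λ {i} _ → reachableValues-antitone k v→w i) (∈-allFin (cls v))
      (reachableValues-drops k v→w effective)

  Φ≤totalImage : ∀ k v → Φ k v ℕ.≤ totalImage cls lam
  Φ≤totalImage k v = sum-mono-≤ (allFin ℓ) (λ {i} _ → length-filter _ (values i))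

theorem2p3 : ∃[ C ] (∀ (n : ℕ) (p : Fin n → Point) (arc : Fin n → Fin n → Bool)
               (vst : Fin n) (ℓ : ℕ) (cls : Fin n → Fin ℓ) (lam : Fin n → ℤ) →
               SimplePolytope4 p → AUSO p arc → Partition cls →
               Acyclic (QuotArc cls arc) → (∀ i → EffDec cls arc lam i) →
               expSteps arc vst ≤ (+ (C * totalImage cls lam)) / 1)
theorem2p3 = 4 , λ where
  n p arc vst ℓ cls lam (_ , _ , simple) (orientation , _) _ quotient-acyclic effDec →
    let open Potential arc cls lam quotient-acyclic effDec
        open RandomEdge arc 4 (outdegree≤4 {p = p} simple orientation) Φ Φ-antitone Φ-drops
    in ℚₚ.≤-trans (expStepsF≤Δ*Φ n vst) (fromℕ-mono-≤ (ℕₚ.*-monoʳ-≤ 4 (Φ≤totalImage n vst)))
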